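{- Let $m>0$. Let $2\le a\le b\le c$ and $2\le a'\le b'\le c'$ be integers with $c\ge c'$ such that $(F(a),F(b),F(c))$ and $(F(a'),F(b'),F(c'))$ are both minimal Markoff $m$-triples (for the same $m$). If $a\in\{2,3\}$ and $c\ge 10$, then $c'=c$ or $c'=c-1$.
   Context: $F(n)$ denotes the $n$-th Fibonacci number, $F(0)=0$, $F(1)=1$, $F(n+1)=F(n)+F(n-1)$. A Markoff $m$-triple is a triple $(x,y,z)$ of positive integers with $x\le y\le z$ satisfying $x^2+y^2+z^2=3xyz+m$; it is minimal if $z\ge 3xy$. -}

module Defs where

open import Data.Nat using (ℕ; zero; suc; _+_; _*_; _≤_; _<_; _≥_)
open import Data.Product using (_×_)
open import Relation.Binary.PropositionalEquality using (_≡_)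

F : ℕ → ℕ
F zero = zero
F (suc zero) = suc zero
F (suc (suc n)) = F (suc n) + F n

MarkoffTriple : ℕ → ℕ → ℕ → ℕ → Set
MarkoffTriple m x y z =
  (0 < x) × (x ≤ y) × (y ≤ z) ×
  (x * x + y * y + z * z ≡ 3 * x * y * z + m)

MinimalMarkoffTriple : ℕ → ℕ → ℕ → ℕ → Set
MinimalMarkoffTriple m x y z = MarkoffTriple m x y z × (z ≥ 3 * x * y)

{-# OPTIONS --safe #-}
-- Write u = F k, v = F (1 + k), so that F (2 + k) = v + u and z = F (4 + k) = 3v + 2u.
-- For x = 1 (resp. x = 2), minimality 3xy ≤ z < 3x F (2 + k) (resp. < 3x v) puts the
-- Fibonacci number y at most v (resp. u). The Markoff quadratic in the middle variable is
-- ≤ m between its roots y and 3xz − y, and evaluating it at v (resp. at u, together with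
-- Cassini's identity) gives F (2 + k)² ≤ m + 4. Any Markoff m-triple with largest entry z′
-- has m + z′ ≤ z′², so c′ ≤ c − 2 would give z′ ≤ F (2 + k), hence z′ ≤ 4, m ≤ 16 and
-- F (2 + k)² ≤ 20, contradicting F (2 + k) ≥ F 8 = 21.

module Submission where

open import Defs
open import Data.Nat using (ℕ; zero; suc; _+_; _*_; _∸_; _≤_; _<_; _≥_; _≤′_; ≤′-refl; ≤′-step; z≤n; s≤s; _≤?_; >-nonZero)
open import Data.Nat.Properties
open import Data.Nat.Tactic.RingSolver using (solve-∀)
open import Data.Product using (_,_)
open import Data.Sum using (_⊎_; inj₁; inj₂)
open import Relation.Binary.PropositionalEquality using (_≡_; refl; sym; trans; cong; module ≡-Reasoning)
open import Relation.Nullary using (¬_; yes; no; contradiction)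
open import Relation.Nullary.Decidable using (from-no)

F-≤-suc : ∀ n → F n ≤ F (suc n)
F-≤-suc zero = z≤n
F-≤-suc (suc zero) = ≤-refl
F-≤-suc (suc (suc n)) = m≤m+n _ _

F-mono′ : ∀ {i j} → i ≤′ j → F i ≤ F j
F-mono′ ≤′-refl = ≤-refl
F-mono′ (≤′-step {n} i≤′n) = ≤-trans (F-mono′ i≤′n) (F-≤-suc n)

F-mono : ∀ {i j} → i ≤ j → F i ≤ F j
F-mono i≤j = F-mono′ (≤⇒≤′ i≤j)

F[b]<F[1+n]⇒F[b]≤F[n] : ∀ b n → F b < F (suc n) → F b ≤ F n
F[b]<F[1+n]⇒F[b]≤F[n] b n Fb<F[1+n] with b ≤? n
... | yes b≤n = F-mono b≤n
... | no b≰n = contradiction (F-mono (≰⇒> b≰n)) (<⇒≱ Fb<F[1+n])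

cassini-step : ∀ a b e e′ → b * b + e ≡ b * a + a * a + e′ →
               (b + a) * (b + a) + e′ ≡ (b + a) * b + b * b + e
cassini-step a b e e′ eq = begin
  (b + a) * (b + a) + e′                ≡⟨ expand a b e′ ⟩
  a * b + (b * a + a * a + e′) + b * b  ≡⟨ cong (λ t → a * b + t + b * b) (sym eq) ⟩
  a * b + (b * b + e) + b * b           ≡⟨ collect a b e ⟩
  (b + a) * b + b * b + e               ∎
  where
  open ≡-Reasoning
  expand : ∀ a b e′ → (b + a) * (b + a) + e′ ≡ a * b + (b * a + a * a + e′) + b * b
  expand = solve-∀
  collect : ∀ a b e → a * b + (b * b + e) + b * b ≡ (b + a) * b + b * b + e
  collect = solve-∀

-- Written with an explicit `+ 0` so that both signs are instances of `cassini-step`.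
cassini : ∀ k → F (suc k) * F (suc k) + 0 ≡ F (suc k) * F k + F k * F k + 1
              ⊎ F (suc k) * F (suc k) + 1 ≡ F (suc k) * F k + F k * F k + 0
cassini zero = inj₁ refl
cassini (suc k) with cassini k
... | inj₁ eq = inj₂ (cassini-step (F k) (F (suc k)) 0 1 eq)
... | inj₂ eq = inj₁ (cassini-step (F k) (F (suc k)) 1 0 eq)

cassini-≤ : ∀ k → F (suc k) * F k + F k * F k ≤ F (suc k) * F (suc k) + 1
cassini-≤ k with cassini k
... | inj₁ eq = ≤-trans (m≤m+n _ 1) (≤-trans (≤-reflexive (sym eq)) (+-monoʳ-≤ _ z≤n))
... | inj₂ eq = ≤-reflexive (trans (sym (+-identityʳ _)) (sym eq))

-- y and 3xz − y are the two roots of Y ↦ x² + Y² + z² − 3xYz − m, which is ≤ 0 between them.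
markoff-≤-between-roots : ∀ {m x y z} Y → x * x + y * y + z * z ≡ 3 * x * y * z + m →
                          y ≤ Y → y + Y ≤ 3 * x * z → x * x + Y * Y + z * z ≤ 3 * x * Y * z + m
markoff-≤-between-roots {m} {x} {y} {z} Y eq y≤Y y+Y≤3xz with m≤n⇒∃[o]m+o≡n y≤Y
... | d , refl = begin
  x * x + (y + d) * (y + d) + z * z           ≡⟨ expand x y z d ⟩
  x * x + y * y + z * z + d * (y + (y + d))   ≡⟨ cong (_+ d * (y + (y + d))) eq ⟩
  3 * x * y * z + m + d * (y + (y + d))       ≤⟨ +-monoʳ-≤ (3 * x * y * z + m) (*-monoʳ-≤ d y+Y≤3xz) ⟩
  3 * x * y * z + m + d * (3 * x * z)         ≡⟨ collect x y z d m ⟩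
  3 * x * (y + d) * z + m                     ∎
  where
  open ≤-Reasoning
  expand : ∀ x y z d → x * x + (y + d) * (y + d) + z * z ≡ x * x + y * y + z * z + d * (y + (y + d))
  expand = solve-∀
  collect : ∀ x y z d m → 3 * x * y * z + m + d * (3 * x * z) ≡ 3 * x * (y + d) * z + m
  collect = solve-∀

markoff-≤-on-[y,z] : ∀ {m x y z} Y → MarkoffTriple m x y z → y ≤ Y → Y ≤ z →
                     x * x + Y * Y + z * z ≤ 3 * x * Y * z + m
markoff-≤-on-[y,z] {m} {x} {y} {z} Y (0<x , _ , _ , eq) y≤Y Y≤z =
  markoff-≤-between-roots {m} {x} {y} {z} Y eq y≤Y (begin
    y + Y          ≤⟨ +-mono-≤ (≤-trans y≤Y Y≤z) Y≤z ⟩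
    z + z          ≤⟨ +-monoʳ-≤ z (m≤m+n z (z + 0)) ⟩
    3 * z          ≤⟨ *-monoˡ-≤ z (*-monoʳ-≤ 3 0<x) ⟩
    3 * x * z      ∎)
  where open ≤-Reasoning

MarkoffTriple⇒m+z≤z*z : ∀ {m x y z} → MarkoffTriple m x y z → m + z ≤ z * z
MarkoffTriple⇒m+z≤z*z {m} {x} {y} {z} (0<x , x≤y , y≤z , eq) =
  +-cancelˡ-≤ (x * x + y * y) (m + z) (z * z) (begin
    x * x + y * y + (m + z)    ≡⟨ shuffle (x * x) (y * y) m z ⟩
    x * x + y * y + z + m      ≤⟨ +-monoˡ-≤ m x²+y²+z≤3xyz ⟩
    3 * x * y * z + m          ≡⟨ sym eq ⟩
    x * x + y * y + z * z      ∎)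
  where
  open ≤-Reasoning
  shuffle : ∀ a b m z → a + b + (m + z) ≡ a + b + z + m
  shuffle = solve-∀
  0<y : 0 < y
  0<y = ≤-trans 0<x x≤y
  0<z : 0 < z
  0<z = ≤-trans 0<y y≤z
  x²+y²+z≤3xyz : x * x + y * y + z ≤ 3 * x * y * z
  x²+y²+z≤3xyz = begin
    x * x + y * y + z                    ≤⟨ +-mono-≤ (+-mono-≤ x²≤xyz y²≤yzx) z≤xyz ⟩
    x * (y * z) + y * z * x + x * y * z  ≡⟨ collect x y z ⟩
    3 * x * y * z                        ∎
    where
    collect : ∀ x y z → x * (y * z) + y * z * x + x * y * z ≡ 3 * x * y * z
    collect = solve-∀
    x²≤xyz : x * x ≤ x * (y * z)
    x²≤xyz = *-monoʳ-≤ x (≤-trans x≤y (m≤m*n y z ⦃ >-nonZero 0<z ⦄))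
    y²≤yzx : y * y ≤ y * z * x
    y²≤yzx = ≤-trans (*-monoʳ-≤ y y≤z) (m≤m*n (y * z) x ⦃ >-nonZero 0<x ⦄)
    z≤xyz : z ≤ x * y * z
    z≤xyz = m≤n*m z (x * y) ⦃ >-nonZero (*-mono-≤ 0<x 0<y) ⦄

minimal₁⇒F[2+k]²≤m : ∀ {m} b k → 1 ≤ k → MinimalMarkoffTriple m 1 (F b) (F (4 + k)) →
                     F (2 + k) * F (2 + k) ≤ m
minimal₁⇒F[2+k]²≤m {m} b k 1≤k (T , 3y≤z) = +-cancelˡ-≤ (3 * v * z) (w * w) m (begin
  3 * v * z + w * w                                  ≤⟨ +-monoʳ-≤ (3 * v * z) (m≤m+n (w * w) _) ⟩
  3 * v * z + (w * w + (1 + 4 * u * v + 3 * u * u))  ≡⟨ sym (split u v) ⟩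
  1 * 1 + v * v + z * z                              ≤⟨ markoff-≤-on-[y,z] v T y≤v v≤z ⟩
  3 * v * z + m                                      ∎)
  where
  open ≤-Reasoning
  u v w z : ℕ
  u = F k
  v = F (1 + k)
  w = F (2 + k)
  z = F (4 + k)
  z<3w : z < 3 * w
  z<3w = begin-strict
    z      <⟨ m<m+n z (F-mono {1} {k} 1≤k) ⟩
    z + u  ≡⟨ triple u v ⟩
    3 * w  ∎
    where
    triple : ∀ u v → ((v + u) + v) + (v + u) + u ≡ 3 * (v + u)
    triple = solve-∀
  y≤v : F b ≤ v
  y≤v = F[b]<F[1+n]⇒F[b]≤F[n] b (1 + k) (*-cancelˡ-< 3 (F b) w (≤-<-trans 3y≤z z<3w))
  v≤z : v ≤ z
  v≤z = F-mono {1 + k} {4 + k} (+-monoˡ-≤ k (s≤s z≤n))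
  split : ∀ u v → 1 * 1 + v * v + (((v + u) + v) + (v + u)) * (((v + u) + v) + (v + u)) ≡
                  3 * v * (((v + u) + v) + (v + u)) + ((v + u) * (v + u) + (1 + 4 * u * v + 3 * u * u))
  split = solve-∀

minimal₂⇒F[2+k]²≤m+4 : ∀ {m} b k → MinimalMarkoffTriple m 2 (F b) (F (4 + k)) →
                       F (2 + k) * F (2 + k) ≤ m + 4
minimal₂⇒F[2+k]²≤m+4 {m} b k (T , 6y≤z) =
  +-cancelˡ-≤ (6 * u * z + (4 + 8 * (v * v))) (w * w) (m + 4) (begin
    6 * u * z + (4 + 8 * (v * v)) + w * w        ≡⟨ split u v ⟩
    2 * 2 + u * u + z * z + 8 * (v * u + u * u)  ≤⟨ +-mono-≤ (markoff-≤-on-[y,z] u T y≤u u≤z) (*-monoʳ-≤ 8 (cassini-≤ k)) ⟩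
    6 * u * z + m + 8 * (v * v + 1)              ≡⟨ collect (6 * u * z) (v * v) m ⟩
    6 * u * z + (4 + 8 * (v * v)) + (m + 4)      ∎)
  where
  open ≤-Reasoning
  u v w z : ℕ
  u = F k
  v = F (1 + k)
  w = F (2 + k)
  z = F (4 + k)
  z<6v : z < 6 * v
  z<6v = begin-strict
    z              <⟨ m<m+n z (F-mono {1} {1 + k} (s≤s z≤n)) ⟩
    z + v          ≡⟨ expand u v ⟩
    4 * v + 2 * u  ≤⟨ +-monoʳ-≤ (4 * v) (*-monoʳ-≤ 2 (F-≤-suc k)) ⟩
    4 * v + 2 * v  ≡⟨ collect-v v ⟩
    6 * v          ∎
    where
    expand : ∀ u v → ((v + u) + v) + (v + u) + v ≡ 4 * v + 2 * u
    expand = solve-∀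
    collect-v : ∀ v → 4 * v + 2 * v ≡ 6 * v
    collect-v = solve-∀
  y≤u : F b ≤ u
  y≤u = F[b]<F[1+n]⇒F[b]≤F[n] b k (*-cancelˡ-< 6 (F b) v (≤-<-trans 6y≤z z<6v))
  u≤z : u ≤ z
  u≤z = F-mono {k} {4 + k} (m≤n+m k 4)
  split : ∀ u v → 6 * u * (((v + u) + v) + (v + u)) + (4 + 8 * (v * v)) + (v + u) * (v + u) ≡
                  2 * 2 + u * u + (((v + u) + v) + (v + u)) * (((v + u) + v) + (v + u)) + 8 * (v * u + u * u)
  split = solve-∀
  collect : ∀ a s m → a + m + 8 * (s + 1) ≡ a + (4 + 8 * s) + (m + 4)
  collect = solve-∀

minimal-F2∨F3⇒F[2+k]²≤m+4 : ∀ {m a} b k → 1 ≤ k → a ≡ 2 ⊎ a ≡ 3 →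
                            MinimalMarkoffTriple m (F a) (F b) (F (4 + k)) →
                            F (2 + k) * F (2 + k) ≤ m + 4
minimal-F2∨F3⇒F[2+k]²≤m+4 {m} b k 1≤k (inj₁ refl) T = ≤-trans (minimal₁⇒F[2+k]²≤m b k 1≤k T) (m≤m+n m 4)
minimal-F2∨F3⇒F[2+k]²≤m+4 b k _ (inj₂ refl) T = minimal₂⇒F[2+k]²≤m+4 b k T

squeezed-square≤20 : ∀ {m z w} → z ≤ w → m + z ≤ z * z → w * w ≤ m + 4 → w * w ≤ 20
squeezed-square≤20 {m} {z} {w} z≤w m+z≤z² w²≤m+4 = ≤-trans w²≤m+4 (+-monoˡ-≤ 4 m≤16)
  where
  z≤4 : z ≤ 4
  z≤4 = +-cancelˡ-≤ m z 4 (≤-trans m+z≤z² (≤-trans (*-mono-≤ z≤w z≤w) w²≤m+4))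
  m≤16 : m ≤ 16
  m≤16 = ≤-trans (m≤m+n m z) (≤-trans m+z≤z² (*-mono-≤ z≤4 z≤4))

≤2+n∧≰n⇒≡2+n∨≡1+n : ∀ {m n} → m ≤ suc (suc n) → ¬ m ≤ n → m ≡ suc (suc n) ⊎ m ≡ suc n
≤2+n∧≰n⇒≡2+n∨≡1+n m≤2+n m≰n with m≤n⇒m<n∨m≡n m≤2+n
... | inj₂ m≡2+n = inj₁ m≡2+n
... | inj₁ (s≤s m≤1+n) with m≤n⇒m<n∨m≡n m≤1+n
...   | inj₂ m≡1+n = inj₂ m≡1+n
...   | inj₁ (s≤s m≤n) = contradiction m≤n m≰n

lemma4p11 : (m a b c a′ b′ c′ : ℕ) → 0 < m →
    2 ≤ a → a ≤ b → b ≤ c → 2 ≤ a′ → a′ ≤ b′ → b′ ≤ c′ → c ≥ c′ →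
    MinimalMarkoffTriple m (F a) (F b) (F c) →
    MinimalMarkoffTriple m (F a′) (F b′) (F c′) →
    (a ≡ 2 ⊎ a ≡ 3) → c ≥ 10 →
    c′ ≡ c ⊎ c′ ≡ c ∸ 1
lemma4p11 m a b (suc (suc (suc (suc k)))) a′ b′ c′ _ _ _ _ _ _ _ c′≤c T (T′ , _) a∈23 (s≤s (s≤s (s≤s (s≤s 6≤k)))) =
  ≤2+n∧≰n⇒≡2+n∨≡1+n c′≤c c′≰2+k
  where
  w : ℕ
  w = F (2 + k)
  21≤w : 21 ≤ w
  21≤w = F-mono {8} {2 + k} (s≤s (s≤s 6≤k))
  w²≤m+4 : w * w ≤ m + 4
  w²≤m+4 = minimal-F2∨F3⇒F[2+k]²≤m+4 b k (≤-trans (s≤s z≤n) 6≤k) a∈23 T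
  c′≰2+k : ¬ c′ ≤ 2 + k
  c′≰2+k c′≤2+k = from-no (441 ≤? 20) (≤-trans (*-mono-≤ 21≤w 21≤w)
    (squeezed-square≤20 (F-mono c′≤2+k) (MarkoffTriple⇒m+z≤z*z T′) w²≤m+4))
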